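{- Let $q$ be a prime power, $n\ge 1$, and let $S\subseteq\{0,1,\ldots,n\}$ be non-empty. If $q=2$, assume further that $0,n\notin S$. Then for all $i\in\mathbb{Z}_{q^n-1}$ we have $\delta_{n-S}(i)=\delta_S(Q_n-i)$, where $Q_n=(q^n-1)/(q-1)$. Hence $\delta_{n-S}$ is a shift of the reversal of $\delta_S$.
   Context: Let $p$ be the characteristic of $\mathbb{F}_q$. Define $\Omega(0)=\{0\}\subseteq\mathbb{Z}_{q^n-1}$ and for $1\le w\le n$, $\Omega(w)$ is the set of $k\in\mathbb{Z}_{q^n-1}$ whose canonical representative in $\{0,\ldots,q^n-2\}$ equals $q^{i_1}+\cdots+q^{i_w}$ for some $0\le i_1<\cdots<i_w\le n-1$. For $W\subseteq[0,n]$, $\delta_W:\mathbb{Z}_{q^n-1}\to\mathbb{F}_p$ is the indicator function of $\bigcup_{w\in W}\Omega(w)$. $n-S=\{n-s:s\in S\}$. For $f$ on $\mathbb{Z}_N$, the $k$-shift is $i\mapsto f(i+k)$ and the reversal is $f^*(i)=f(-(1+i))$. -}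

module Defs where

open import Data.Bool using (Bool; true; false; _∧_; if_then_else_)
open import Data.Nat using (ℕ; zero; suc; _+_; _*_; _∸_; _^_; _≡ᵇ_; _/_; _%_)
open import Data.Fin using (Fin; toℕ; opposite)
open import Data.Fin.Subset using (Subset; ∣_∣)
open import Data.Vec using (Vec; []; _∷_; lookup; tabulate)
open import Data.List using (List; []; _∷_; _++_; map; allFin)
open import Data.Nat.ListAction using (sum)
open import Data.Bool.ListAction using (any)

subsets : (n : ℕ) → List (Subset n)
subsets zero    = [] ∷ []
subsets (suc n) = map (true ∷_) (subsets n) ++ map (false ∷_) (subsets n)

powsum : (q : ℕ) {n : ℕ} → Subset n → ℕ
powsum q {n} I = sum (map (λ i → if lookup I i then q ^ toℕ i else 0) (allFin n))

-- Membership of the residue with canonical representative k in Ω(w):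
-- Ω(0) = {0};  Ω(w) (w ≥ 1) = {k : k = q^{i_1}+…+q^{i_w}, 0 ≤ i_1 < … < i_w ≤ n-1}.
Ω : (q n w k : ℕ) → Bool
Ω q n zero    k = k ≡ᵇ 0
Ω q n (suc w) k = any (λ I → (∣ I ∣ ≡ᵇ suc w) ∧ (powsum q I ≡ᵇ k)) (subsets n)

-- δ_W for W ⊆ [0,n] (W a subset of Fin (suc n)), evaluated at the residue
-- with canonical representative k ∈ {0,…,q^n-2}. Values in {0,1} ⊆ F_p, as Bool
-- (true = 1, false = 0).
δ : (q n : ℕ) → Subset (suc n) → ℕ → Bool
δ q n W k = any (λ w → lookup W w ∧ Ω q n (toℕ w) k) (allFin (suc n))

reflect : {n : ℕ} → Subset (suc n) → Subset (suc n)
reflect S = tabulate (λ j → lookup S (opposite j))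

-- Reduction modulo N (N = 0 never occurs in the statement: N = q^n - 1 ≥ 1).
modN : ℕ → ℕ → ℕ
modN a zero    = a
modN a (suc m) = a % suc m

divN : ℕ → ℕ → ℕ
divN a zero    = 0
divN a (suc m) = a / suc m

Qn : ℕ → ℕ → ℕ
Qn q n = divN (q ^ n ∸ 1) (q ∸ 1)

-- Functions on Z_N represented by canonical representatives.
-- k-shift: i ↦ f(i + k);  reversal: f*(i) = f(-(1+i)).
shift : (N k : ℕ) → (ℕ → Bool) → ℕ → Bool
shift N k f i = f (modN (i + k) N)

rev : (N : ℕ) → (ℕ → Bool) → ℕ → Bool
rev N f i = f (modN (N ∸ suc (modN i N)) N)

module Submission where

-- Complementation in {0,…,n−1} sends a w-subset I with Σ_{i∈I} qⁱ = k to an (n−w)-subset with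
-- sum Q_n − k, so Ω(w) and Ω(n−w) are exchanged by k ↦ Q_n − k (mod qⁿ − 1), which is exactly
-- δ_{n−S}(i) = δ_S(Q_n − i). Only for q = 2 is Q_n = qⁿ − 1 ≡ 0, so that Ω(n) = {Q_n} contains no
-- canonical residue; then 0, n ∉ S makes both sides vanish at i = 0. Finally i ↦ Q_n − i is the
-- k-shift of the reversal i ↦ −1 − i for k ≡ −1 − Q_n.

open import Defs
open import Data.Nat using (ℕ; suc; _+_; _∸_; _^_; _<_; _≤_)
open import Data.Nat.Primality using (Prime)
open import Data.Fin using (zero; fromℕ)
open import Data.Fin.Subset using (Subset; Nonempty; _∉_)
open import Data.Product using (_×_; ∃-syntax)
open import Relation.Binary.PropositionalEquality using (_≡_)

open import Data.Bool.Base using (Bool; true; false; T; not; _∧_; if_then_else_)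
open import Data.Bool.Properties using (T-∧; T-≡)
open import Data.Empty using (⊥-elim)
open import Data.Fin.Base using (Fin; toℕ; opposite) renaming (suc to fsuc)
open import Data.Fin.Properties using (opposite-prop; opposite-involutive; toℕ-injective)
open import Data.Fin.Subset using (∣_∣; ⊤; ⊥; ∁)
open import Data.Fin.Subset.Properties using (∣⊥∣≡0; ∣∁p∣≡n∸∣p∣)
open import Data.List.Base using ([]; _∷_; map; allFin; tabulate)
open import Data.List.Membership.Propositional using (lose) renaming (_∈_ to _∈ˡ_)
open import Data.List.Membership.Propositional.Properties using (∈-map⁺; ∈-++⁺ˡ; ∈-++⁺ʳ; ∈-allFin)
open import Data.List.Properties using (map-tabulate; map-cong)
open import Data.List.Relation.Unary.Any using (here; satisfied)
open import Data.List.Relation.Unary.Any.Properties using (any⁺; any⁻)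
open import Data.Nat.Base using (zero; _*_; _≡ᵇ_; z≤n; s≤s; NonZero)
open import Data.Nat.DivMod using (_%_; _/_; m*n/n≡m; m%n%n≡m%n; %-distribˡ-+; m%n<n; n%n≡0; m<n⇒m%n≡m; m≤n⇒m%n≡m; [m+n]%n≡m%n; m≤n⇒[n∸m]%m≡n%m)
open import Data.Nat.ListAction using (sum)
open import Data.Nat.Solver using (module +-*-Solver)
open import Data.Nat.Properties
open import Data.Product using (∃; _,_; proj₁; proj₂)
open import Data.Sum using (_⊎_; inj₁; inj₂)
open import Data.Vec.Base using ([]; _∷_; lookup)
open import Data.Vec.Properties using (lookup⇒[]=; lookup∘tabulate; tabulate∘lookup; tabulate-cong)
open import Function.Base using (_∘_; id)
open import Function.Bundles using (Equivalence)
open import Relation.Binary.PropositionalEquality using (refl; sym; trans; cong; cong₂; subst; subst₂; module ≡-Reasoning)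
open import Relation.Nullary using (¬_; yes; no)

T⇔T→≡ : ∀ {a b} → (T a → T b) → (T b → T a) → a ≡ b
T⇔T→≡ {false} {false} _ _ = refl
T⇔T→≡ {false} {true}  _ g = ⊥-elim (g _)
T⇔T→≡ {true}  {false} f _ = ⊥-elim (f _)
T⇔T→≡ {true}  {true}  _ _ = refl

sum-map-*ˡ : ∀ {A : Set} q (f : A → ℕ) xs → sum (map (λ x → q * f x) xs) ≡ q * sum (map f xs)
sum-map-*ˡ q f []       = sym (*-zeroʳ q)
sum-map-*ˡ q f (x ∷ xs) = trans (cong (q * f x +_) (sum-map-*ˡ q f xs)) (sym (*-distribˡ-+ q (f x) _))

powsum-∷ : ∀ q {n} b (I : Subset n) → powsum q (b ∷ I) ≡ (if b then 1 else 0) + q * powsum q I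
powsum-∷ q {n} b I = cong ((if b then 1 else 0) +_) (begin
    sum (map term (tabulate fsuc))              ≡⟨ cong sum (map-tabulate fsuc term) ⟩
    sum (tabulate (term ∘ fsuc))                ≡⟨ cong sum (map-tabulate id (term ∘ fsuc)) ⟨
    sum (map (term ∘ fsuc) (allFin n))          ≡⟨ cong sum (map-cong term-suc (allFin n)) ⟩
    sum (map (λ i → q * term′ i) (allFin n))    ≡⟨ sum-map-*ˡ q term′ (allFin n) ⟩
    q * powsum q I                              ∎)
  where
  open ≡-Reasoning
  term : Fin (suc n) → ℕ
  term i = if lookup (b ∷ I) i then q ^ toℕ i else 0
  term′ : Fin n → ℕ
  term′ i = if lookup I i then q ^ toℕ i else 0
  term-suc : ∀ i → term (fsuc i) ≡ q * term′ i
  term-suc i with lookup I i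
  ... | true  = refl
  ... | false = sym (*-zeroʳ q)

powsum-∁ : ∀ q {n} (I : Subset n) → powsum q I + powsum q (∁ I) ≡ powsum q (⊤ {n})
powsum-∁ q []      = refl
powsum-∁ q {suc n} (b ∷ I) = begin
    powsum q (b ∷ I) + powsum q (not b ∷ ∁ I)   ≡⟨ cong₂ _+_ (powsum-∷ q b I) (powsum-∷ q (not b) (∁ I)) ⟩
    (bit b + q * x) + (bit (not b) + q * y)     ≡⟨ bits-add b ⟩
    1 + (q * x + q * y)                         ≡⟨ cong suc (sym (*-distribˡ-+ q x y)) ⟩
    1 + q * (x + y)                             ≡⟨ cong (λ z → 1 + q * z) (powsum-∁ q I) ⟩
    1 + q * powsum q (⊤ {n})                    ≡⟨ powsum-∷ q true (⊤ {n}) ⟨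
    powsum q (⊤ {suc n})                        ∎
  where
  open ≡-Reasoning
  x y : ℕ
  x = powsum q I
  y = powsum q (∁ I)
  bit : Bool → ℕ
  bit b = if b then 1 else 0
  bits-add : ∀ b → (bit b + q * x) + (bit (not b) + q * y) ≡ 1 + (q * x + q * y)
  bits-add true  = refl
  bits-add false = +-suc (q * x) (q * y)

∣∣≡0⇒powsum≡0 : ∀ q {n} (I : Subset n) → ∣ I ∣ ≡ 0 → powsum q I ≡ 0
∣∣≡0⇒powsum≡0 q []          _ = refl
∣∣≡0⇒powsum≡0 q (false ∷ I) e = trans (powsum-∷ q false I) (trans (cong (q *_) (∣∣≡0⇒powsum≡0 q I e)) (*-zeroʳ q))

∣∣≤powsum : ∀ q {n} (I : Subset n) → 1 ≤ q → ∣ I ∣ ≤ powsum q I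
∣∣≤powsum q []          _ = z≤n
∣∣≤powsum q@(suc _) (b ∷ I) _ = subst (∣ b ∷ I ∣ ≤_) (sym (powsum-∷ q b I)) (step b)
  where
  ∣I∣≤q*powsum : ∣ I ∣ ≤ q * powsum q I
  ∣I∣≤q*powsum = ≤-trans (∣∣≤powsum q I (s≤s z≤n)) (m≤n*m (powsum q I) q)
  step : ∀ b → ∣ b ∷ I ∣ ≤ (if b then 1 else 0) + q * powsum q I
  step true  = s≤s ∣I∣≤q*powsum
  step false = ∣I∣≤q*powsum

powsum⊤*c+1≡[1+c]^n : ∀ c n → powsum (suc c) (⊤ {n}) * c + 1 ≡ suc c ^ n
powsum⊤*c+1≡[1+c]^n c zero    = refl
powsum⊤*c+1≡[1+c]^n c (suc n) = begin
    powsum q (⊤ {suc n}) * c + 1   ≡⟨ cong (λ z → z * c + 1) (powsum-∷ q true (⊤ {n})) ⟩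
    (1 + q * R) * c + 1            ≡⟨ solve 2 (λ R c → (con 1 :+ (con 1 :+ c) :* R) :* c :+ con 1
                                                 := (con 1 :+ c) :* (R :* c :+ con 1)) refl R c ⟩
    q * (R * c + 1)                ≡⟨ cong (q *_) (powsum⊤*c+1≡[1+c]^n c n) ⟩
    q * q ^ n                      ∎
  where
  open ≡-Reasoning
  open +-*-Solver
  q R : ℕ
  q = suc c
  R = powsum q (⊤ {n})

∈-subsets : ∀ {n} (I : Subset n) → I ∈ˡ subsets n
∈-subsets []                = here refl
∈-subsets {suc n} (true ∷ I)  = ∈-++⁺ˡ (∈-map⁺ (true ∷_) (∈-subsets I))
∈-subsets {suc n} (false ∷ I) = ∈-++⁺ʳ (map (true ∷_) (subsets n)) (∈-map⁺ (false ∷_) (∈-subsets I))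

Ω⁺ : ∀ q {n} (I : Subset n) → T (Ω q n ∣ I ∣ (powsum q I))
Ω⁺ q {n} I with ∣ I ∣ in ∣I∣≡w
... | zero  = ≡⇒≡ᵇ (powsum q I) 0 (∣∣≡0⇒powsum≡0 q I ∣I∣≡w)
... | suc w = any⁺ _ (lose (∈-subsets I) (Equivalence.from T-∧ (≡⇒≡ᵇ _ _ ∣I∣≡w , ≡⇒≡ᵇ (powsum q I) _ refl)))

Ω⁻ : ∀ q n w k → T (Ω q n w k) → ∃ λ (I : Subset n) → ∣ I ∣ ≡ w × powsum q I ≡ k
Ω⁻ q n zero    k k≡0 = ⊥ , ∣⊥∣≡0 n , trans (∣∣≡0⇒powsum≡0 q (⊥ {n}) (∣⊥∣≡0 n)) (sym (≡ᵇ⇒≡ k 0 k≡0))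
Ω⁻ q n (suc w) k k∈Ω with satisfied (any⁻ (λ I → (∣ I ∣ ≡ᵇ suc w) ∧ (powsum q I ≡ᵇ k)) (subsets n) k∈Ω)
... | I , ∣I∣≡w∧powsum≡k with Equivalence.to T-∧ ∣I∣≡w∧powsum≡k
...   | ∣I∣≡w , powsum≡k = I , ≡ᵇ⇒≡ _ _ ∣I∣≡w , ≡ᵇ⇒≡ _ _ powsum≡k

δ⁺ : ∀ q n W k w → T (lookup W w) → T (Ω q n (toℕ w) k) → T (δ q n W k)
δ⁺ q n W k w w∈W k∈Ω = any⁺ _ (lose (∈-allFin w) (Equivalence.from T-∧ (w∈W , k∈Ω)))

δ⁻ : ∀ q n W k → T (δ q n W k) → ∃[ w ] T (lookup W w) × T (Ω q n (toℕ w) k)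
δ⁻ q n W k k∈δ with satisfied (any⁻ (λ w → lookup W w ∧ Ω q n (toℕ w) k) (allFin (suc n)) k∈δ)
... | w , w∈W∧k∈Ω = w , Equivalence.to T-∧ w∈W∧k∈Ω

-- i + j ≡ R (mod N) for residues i, j < N ≥ R, without reduction modulo N: for R = N this excludes
-- i = j = 0, the one pair where Ω(0) = {0} and Ω(n) = {R} do not correspond.
Complementary : (N R i j : ℕ) → Set
Complementary N R i j = i + j ≡ R ⊎ i + j ≡ R + N

complementary-sym : ∀ {N R i j} → Complementary N R i j → Complementary N R j i
complementary-sym {i = i} {j} (inj₁ i+j≡R)   = inj₁ (trans (+-comm j i) i+j≡R)
complementary-sym {i = i} {j} (inj₂ i+j≡R+N) = inj₂ (trans (+-comm j i) i+j≡R+N)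

complementary-unique : ∀ {N R i j j′} → j < N → Complementary N R i j → i + j′ ≡ R → j ≡ j′
complementary-unique {i = i} {j} {j′} _ (inj₁ i+j≡R) i+j′≡R = +-cancelˡ-≡ i j j′ (trans i+j≡R (sym i+j′≡R))
complementary-unique {N} {R} {i} {j} {j′} j<N (inj₂ i+j≡R+N) i+j′≡R =
  ⊥-elim (<⇒≱ j<N (subst (N ≤_) (sym j≡j′+N) (m≤n+m N j′)))
  where
  j≡j′+N : j ≡ j′ + N
  j≡j′+N = +-cancelˡ-≡ i j (j′ + N) (trans i+j≡R+N (trans (cong (_+ N) (sym i+j′≡R)) (+-assoc i j′ N)))

Ω-complement : ∀ q n {N w i j} → j < N → Complementary N (powsum q (⊤ {n})) i j →
               T (Ω q n w i) → T (Ω q n (n ∸ w) j)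
Ω-complement q n {w = w} {i} {j} j<N i+j≡R i∈Ω with Ω⁻ q n w i i∈Ω
... | I , refl , refl = subst₂ (λ w k → T (Ω q n w k)) (∣∁p∣≡n∸∣p∣ I) (sym j≡powsum∁I) (Ω⁺ q (∁ I))
  where
  j≡powsum∁I : j ≡ powsum q (∁ I)
  j≡powsum∁I = complementary-unique j<N i+j≡R (powsum-∁ q I)

reflect-involutive : ∀ {n} (S : Subset (suc n)) → reflect (reflect S) ≡ S
reflect-involutive S = trans (tabulate-cong lookup-reflect²) (tabulate∘lookup S)
  where
  lookup-reflect² : ∀ j → lookup (reflect S) (opposite j) ≡ lookup S j
  lookup-reflect² j = trans (lookup∘tabulate (λ k → lookup S (opposite k)) (opposite j))
                            (cong (lookup S) (opposite-involutive j))

δ-reflect⇒δ-complement : ∀ q n {N} (S : Subset (suc n)) {i j} → j < N → Complementary N (powsum q (⊤ {n})) i j →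
                       T (δ q n (reflect S) i) → T (δ q n S j)
δ-reflect⇒δ-complement q n S {i} {j} j<N i+j≡R i∈δ with δ⁻ q n (reflect S) i i∈δ
... | w , w∈reflectS , i∈Ω = δ⁺ q n S _ (opposite w)
  (subst T (lookup∘tabulate (λ k → lookup S (opposite k)) w) w∈reflectS)
  (subst (λ v → T (Ω q n v _)) (sym (opposite-prop w)) (Ω-complement q n {w = toℕ w} j<N i+j≡R i∈Ω))

δ-reflect≡δ-complement : ∀ q n {N} (S : Subset (suc n)) {i j} → i < N → j < N →
                        Complementary N (powsum q (⊤ {n})) i j → δ q n (reflect S) i ≡ δ q n S j
δ-reflect≡δ-complement q n S {i} {j} i<N j<N i+j≡R = T⇔T→≡
  (δ-reflect⇒δ-complement q n S j<N i+j≡R)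
  (λ j∈δ → δ-reflect⇒δ-complement q n (reflect S) i<N (complementary-sym {i = i} {j} i+j≡R)
             (subst (λ W → T (δ q n W j)) (sym (reflect-involutive S)) j∈δ))

m+[n∸[m+o]]≡n∸o : ∀ m {n o} → m + o ≤ n → m + (n ∸ (m + o)) ≡ n ∸ o
m+[n∸[m+o]]≡n∸o m {n} {o} m+o≤n = trans (sym (+-∸-assoc m m+o≤n)) ([m+n]∸[m+o]≡n∸o m n o)

m+o+[n∸m]≡o+n : ∀ {m n} o → m ≤ n → m + o + (n ∸ m) ≡ o + n
m+o+[n∸m]≡o+n {m} {n} o m≤n = begin
  m + o + (n ∸ m)   ≡⟨ cong (_+ (n ∸ m)) (+-comm m o) ⟩
  o + m + (n ∸ m)   ≡⟨ +-assoc o m (n ∸ m) ⟩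
  o + (m + (n ∸ m)) ≡⟨ cong (o +_) (m+[n∸m]≡n m≤n) ⟩
  o + n             ∎
  where open ≡-Reasoning

complementary-% : ∀ {N R i x} .{{_ : NonZero N}} → x < N + N → i + x ≡ R + N → Complementary N R i (x % N)
complementary-% {N} {R} {i} {x} x<N+N i+x≡R+N with x <? N
... | yes x<N = inj₂ (trans (cong (i +_) (m<n⇒m%n≡m x<N)) i+x≡R+N)
... | no  x≮N = inj₁ (+-cancelʳ-≡ N (i + x % N) R (begin
    i + x % N + N      ≡⟨ +-assoc i (x % N) N ⟩
    i + (x % N + N)    ≡⟨ cong (λ y → i + (y + N)) x%N≡x∸N ⟩
    i + (x ∸ N + N)    ≡⟨ cong (i +_) (m∸n+n≡m N≤x) ⟩
    i + x              ≡⟨ i+x≡R+N ⟩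
    R + N              ∎))
  where
  open ≡-Reasoning
  N≤x : N ≤ x
  N≤x = ≮⇒≥ x≮N
  x∸N<N : x ∸ N < N
  x∸N<N = subst (x ∸ N <_) (m+n∸n≡m N N) (∸-monoˡ-< x<N+N N≤x)
  x%N≡x∸N : x % N ≡ x ∸ N
  x%N≡x∸N = trans (sym (m≤n⇒[n∸m]%m≡n%m N≤x)) (m<n⇒m%n≡m x∸N<N)

reverse-shift-% : ∀ M c i → c ≤ M → i ≤ M → M ∸ (i + (M ∸ c)) % suc M ≡ (c + (suc M ∸ i)) % suc M
reverse-shift-% M c i c≤M i≤M with i ≤? c
... | yes i≤c with t , refl ← m≤n⇒∃[o]m+o≡n i≤c = begin
    M ∸ (i + (M ∸ (i + t))) % suc M   ≡⟨ cong (λ y → M ∸ y % suc M) (m+[n∸[m+o]]≡n∸o i c≤M) ⟩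
    M ∸ (M ∸ t) % suc M               ≡⟨ cong (M ∸_) (m≤n⇒m%n≡m (m∸n≤m M t)) ⟩
    M ∸ (M ∸ t)                       ≡⟨ m∸[m∸n]≡n t≤M ⟩
    t                                 ≡⟨ m≤n⇒m%n≡m t≤M ⟨
    t % suc M                         ≡⟨ [m+n]%n≡m%n t (suc M) ⟨
    (t + suc M) % suc M               ≡⟨ cong (_% suc M) (m+o+[n∸m]≡o+n t (m≤n⇒m≤1+n i≤M)) ⟨
    (i + t + (suc M ∸ i)) % suc M     ∎
  where
  open ≡-Reasoning
  t≤M : t ≤ M
  t≤M = m+n≤o⇒n≤o i c≤M
... | no i≰c with t , refl ← m≤n⇒∃[o]m+o≡n (≰⇒> i≰c) = begin
    M ∸ (suc c + t + (M ∸ c)) % suc M ≡⟨ cong (λ y → M ∸ suc y % suc M) (m+o+[n∸m]≡o+n t c≤M) ⟩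
    M ∸ suc (t + M) % suc M           ≡⟨ cong (λ y → M ∸ y % suc M) (+-suc t M) ⟨
    M ∸ (t + suc M) % suc M           ≡⟨ cong (M ∸_) ([m+n]%n≡m%n t (suc M)) ⟩
    M ∸ t % suc M                     ≡⟨ cong (M ∸_) (m≤n⇒m%n≡m t≤M) ⟩
    M ∸ t                             ≡⟨ m≤n⇒m%n≡m (m∸n≤m M t) ⟨
    (M ∸ t) % suc M                   ≡⟨ cong (_% suc M) (m+[n∸[m+o]]≡n∸o c (≤-trans (n≤1+n (c + t)) i≤M)) ⟨
    (c + (M ∸ (c + t))) % suc M       ∎
  where
  open ≡-Reasoning
  t≤M : t ≤ M
  t≤M = m+n≤o⇒n≤o (suc c) i≤M

δ-at-0 : ∀ q n (W : Subset (suc n)) → 1 ≤ q → ¬ T (lookup W zero) → δ q n W 0 ≡ false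
δ-at-0 q n W 1≤q 0∉W = T⇔T→≡ 0∉δ λ ()
  where
  0∉δ : T (δ q n W 0) → T false
  0∉δ 0∈δ with δ⁻ q n W 0 0∈δ
  ... | w , w∈W , 0∈Ω with Ω⁻ q n (toℕ w) 0 0∈Ω
  ...   | I , ∣I∣≡w , powsum≡0 = 0∉W (subst (T ∘ lookup W) w≡0 w∈W)
    where
    w≡0 : w ≡ zero
    w≡0 = toℕ-injective (n≤0⇒n≡0 (subst₂ _≤_ ∣I∣≡w powsum≡0 (∣∣≤powsum q I 1≤q)))

∉⇒¬T-lookup : ∀ {n} {x : Fin n} (S : Subset n) → x ∉ S → ¬ T (lookup S x)
∉⇒¬T-lookup {x = x} S x∉S x∈S = x∉S (lookup⇒[]= x S (Equivalence.to T-≡ x∈S))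

shifted-reversal : ∀ M R (f g : ℕ → Bool) → (∀ i → i < suc M → g i ≡ f ((R + (suc M ∸ i)) % suc M)) →
  ∃[ k ] k < suc M × (∀ i → i < suc M → g i ≡ shift (suc M) k (rev (suc M) f) i)
shifted-reversal M R f g g≡f[R-i] = M ∸ c , s≤s (m∸n≤m M c) , λ i i<N → begin
    g i                                 ≡⟨ g≡f[R-i] i i<N ⟩
    f ((R + (N ∸ i)) % N)               ≡⟨ cong f (%-absorbˡ R (N ∸ i)) ⟨
    f ((c + (N ∸ i)) % N)               ≡⟨ cong f (reverse-shift-% M c i c≤M (≤-pred i<N)) ⟨
    f (M ∸ (i + k) % N)                 ≡⟨ cong f (m≤n⇒m%n≡m (m∸n≤m M ((i + k) % N))) ⟨
    f ((M ∸ (i + k) % N) % N)           ≡⟨ cong (λ y → f ((M ∸ y) % N)) (m%n%n≡m%n (i + k) N) ⟨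
    shift N k (rev N f) i               ∎
  where
  open ≡-Reasoning
  N c k : ℕ
  N = suc M
  c = R % N
  k = M ∸ c
  c≤M : c ≤ M
  c≤M = ≤-pred (m%n<n R N)
  %-absorbˡ : ∀ x y → (x % N + y) % N ≡ (x + y) % N
  %-absorbˡ x y = begin
    (x % N + y) % N                ≡⟨ %-distribˡ-+ (x % N) y N ⟩
    (x % N % N + y % N) % N        ≡⟨ cong (λ z → (z + y % N) % N) (m%n%n≡m%n x N) ⟩
    (x % N + y % N) % N            ≡⟨ %-distribˡ-+ x y N ⟨
    (x + y) % N                    ∎

module _ (q n M : ℕ) (S : Subset (suc n)) (1≤q : 1 ≤ q) (R≤N : powsum q (⊤ {n}) ≤ suc M)
         (R≡N⇒ends∉S : powsum q (⊤ {n}) ≡ suc M → zero ∉ S × fromℕ n ∉ S) where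

  δ-reflect≡δ[R∸i] : ∀ i → i < suc M → δ q n (reflect S) i ≡ δ q n S ((powsum q (⊤ {n}) + (suc M ∸ i)) % suc M)
  δ-reflect≡δ[R∸i] i i<N = by-cases i i<N (m≤n⇒m<n∨m≡n R≤N)
    where
    open ≡-Reasoning
    R N : ℕ
    R = powsum q (⊤ {n})
    N = suc M

    via-complement : ∀ i → i < N → R + (N ∸ i) < N + N → δ q n (reflect S) i ≡ δ q n S ((R + (N ∸ i)) % N)
    via-complement i i<N x<N+N = δ-reflect≡δ-complement q n S i<N (m%n<n (R + (N ∸ i)) N) (complementary-% x<N+N
      (trans (sym (+-assoc i R (N ∸ i))) (m+o+[n∸m]≡o+n R (<⇒≤ i<N))))

    by-cases : ∀ i → i < N → R < N ⊎ R ≡ N → δ q n (reflect S) i ≡ δ q n S ((R + (N ∸ i)) % N)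
    by-cases i       i<N (inj₁ R<N) = via-complement i i<N (+-mono-<-≤ R<N (m∸n≤m N i))
    by-cases (suc j) i<N (inj₂ R≡N) = via-complement (suc j) i<N (+-mono-≤-< R≤N (s≤s (m∸n≤m M j)))
    by-cases zero    _   (inj₂ R≡N) = begin
      δ q n (reflect S) 0      ≡⟨ δ-at-0 q n (reflect S) 1≤q (∉⇒¬T-lookup S (proj₂ (R≡N⇒ends∉S R≡N))) ⟩
      false                    ≡⟨ δ-at-0 q n S 1≤q (∉⇒¬T-lookup S (proj₁ (R≡N⇒ends∉S R≡N))) ⟨
      δ q n S 0                ≡⟨ cong (δ q n S) (trans ([m+n]%n≡m%n N N) (n%n≡0 N)) ⟨
      δ q n S ((N + N) % N)    ≡⟨ cong (λ R → δ q n S ((R + N) % N)) R≡N ⟨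
      δ q n S ((R + N) % N)    ∎

  δ-reflect-shifted-reversal :
    (∀ i → i < suc M → δ q n (reflect S) i ≡ δ q n S ((powsum q (⊤ {n}) + (suc M ∸ i)) % suc M))
    × ∃[ k ] k < suc M × (∀ i → i < suc M → δ q n (reflect S) i ≡ shift (suc M) k (rev (suc M) (δ q n S)) i)
  δ-reflect-shifted-reversal =
    δ-reflect≡δ[R∸i] , shifted-reversal M (powsum q (⊤ {n})) (δ q n S) (δ q n (reflect S)) δ-reflect≡δ[R∸i]

2≤prime-power : ∀ {q} → ∃[ p ] ∃[ m ] (Prime p × q ≡ p ^ suc m) → 2 ≤ q
2≤prime-power (p@(suc (suc _)) , m , _ , refl) = ≤-trans (s≤s (s≤s z≤n)) (m≤m*n p (p ^ m) {{m^n≢0 p m}})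

[1+c]^n∸1≡powsum⊤*c : ∀ c n → suc c ^ n ∸ 1 ≡ powsum (suc c) (⊤ {n}) * c
[1+c]^n∸1≡powsum⊤*c c n = trans (cong (_∸ 1) (sym (powsum⊤*c+1≡[1+c]^n c n))) (m+n∸n≡m _ 1)

Qn≡powsum⊤ : ∀ d n → Qn (2 + d) n ≡ powsum (2 + d) (⊤ {n})
Qn≡powsum⊤ d n = trans (cong (_/ suc d) ([1+c]^n∸1≡powsum⊤*c (suc d) n)) (m*n/n≡m _ (suc d))

lemma4p1 : (q n : ℕ) → (∃[ p ] ∃[ m ] (Prime p × q ≡ p ^ suc m)) → 1 ≤ n →
    (S : Subset (suc n)) → Nonempty S → (q ≡ 2 → (zero ∉ S) × (fromℕ n ∉ S)) →
    ((i : ℕ) → i < q ^ n ∸ 1 →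
      δ q n (reflect S) i ≡ δ q n S (modN (Qn q n + ((q ^ n ∸ 1) ∸ i)) (q ^ n ∸ 1)))
    × (∃[ k ] (k < q ^ n ∸ 1 × ((i : ℕ) → i < q ^ n ∸ 1 →
      δ q n (reflect S) i ≡ shift (q ^ n ∸ 1) k (rev (q ^ n ∸ 1) (δ q n S)) i)))
-- After the rewrite, N = R * suc d is definitionally a successor (R = powsum q (true ∷ ⊤) unfolds
-- to 1 + …), so it matches the suc M of the general theorem.
lemma4p1 q (suc n) q-prime-power (s≤s z≤n) S _ q≡2⇒ends∉S with 2≤prime-power q-prime-power
... | s≤s (s≤s {n = d} z≤n) rewrite Qn≡powsum⊤ d (suc n) | [1+c]^n∸1≡powsum⊤*c (suc d) (suc n) =
  δ-reflect-shifted-reversal (2 + d) (suc n) _ S (s≤s z≤n) (m≤m*n R (suc d)) R≡N⇒ends∉S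
  where
  R : ℕ
  R = powsum (2 + d) (⊤ {suc n})
  R≡N⇒ends∉S : R ≡ R * suc d → zero ∉ S × fromℕ (suc n) ∉ S
  R≡N⇒ends∉S R≡R*[1+d] = q≡2⇒ends∉S (cong (2 +_) (sym (suc-injective (*-cancelˡ-≡ 1 (suc d) R (trans (*-identityʳ R) R≡R*[1+d])))))
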